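{- Let $1\le a<b$ be integers, and suppose there are infinitely many $n\in\mathbb{N}$ such that $an+1$ and $bn+1$ are both prime. Let $a'=a/\gcd(a,b)$, $b'=b/\gcd(a,b)$ and \[\kappa(a,b)=(b'-a')\prod_{p\mid a'b'}p,\] the product over primes $p$ dividing $a'b'$. Then for every positive integer $k$ that is a multiple of $\kappa(a,b)$, the equation $\phi(n+k)=\phi(n)$ has infinitely many solutions $n\in\mathbb{N}$.
   Context: $\phi$ denotes Euler's totient function. -}

module Defs where

open import Data.Nat using (ℕ; zero; suc; _+_; _*_; _∸_; _≤_)
open import Data.Nat.DivMod using (_/_)
open import Data.Nat.GCD using (gcd)
open import Data.Nat.Coprimality using (Coprime; coprime?)
open import Data.Nat.Primality using (Prime; prime?)
open import Data.Nat.Divisibility using (_∣_; _∣?_)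
open import Data.List using (List; length; filter; upTo; map)
open import Data.Nat.ListAction using (product)
open import Relation.Nullary.Decidable using (_×-dec_)

φ : ℕ → ℕ
φ n = length (filter (λ m → coprime? m n) (map suc (upTo n)))

_÷_ : ℕ → ℕ → ℕ
m ÷ zero  = zero
m ÷ suc d = m / suc d

-- product of the distinct primes dividing n  (for n ≥ 1)
rad : ℕ → ℕ
rad n = product (filter (λ p → prime? p ×-dec (p ∣? n)) (upTo (suc n)))

κ : ℕ → ℕ → ℕ
κ a b = (b' ∸ a') * rad (a' * b')
  where
  a' = a ÷ gcd a b
  b' = b ÷ gcd a b

{-# OPTIONS --safe #-}
module Submission where

-- Put a′ = a / gcd(a,b) and b′ = b / gcd(a,b), so a′b = b′a, and write k = c κ(a,b) = (b′ − a′) M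
-- with M = c · rad(a′b′). If p = an + 1 and q = bn + 1 are prime then
--   q · a′M + (b′ − a′) M = p · b′M.
-- Every prime factor of a′ and b′ divides M, so φ(a′M) = a′ φ(M) and φ(b′M) = b′ φ(M); and for
-- n ≥ b′M neither p divides b′M nor q divides a′M. Hence
--   φ(q · a′M) = bn · a′ φ(M) = an · b′ φ(M) = φ(p · b′M),
-- so w = q · a′M solves φ(w + k) = φ(w), and w ≥ n is as large as we like.

open import Defs
open import Data.Nat using (ℕ; zero; suc; _+_; _*_; _∸_; _≤_; _<_; _≟_; NonZero; >-nonZero; s≤s; z≤n; z<s)
open import Data.Nat.Properties
open import Data.Nat.Divisibility using (_∣_; _∣?_; _∣0; divides; ∣-trans; ∣⇒≤; >⇒∤; 0∣⇒≡0; m∣m*n; n∣m*n; ∣n⇒∣m*n; ∣m∣n⇒∣m+n; ∣m+n∣m⇒∣n)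
open import Data.Nat.DivMod using (m/n*n≡m)
open import Data.Nat.GCD using (gcd; gcd[m,n]∣m; gcd[m,n]∣n)
open import Data.Nat.Coprimality using (Coprime; coprime?; coprime-+; coprime-divisor)
import Data.Nat.Coprimality as Coprimality
open import Data.Nat.Primality using (Prime; prime?; prime[2]; prime⇒nonZero; ¬prime[1]; prime⇒irreducible; productOfPrimes≢0)
open import Data.Nat.Primality.Factorisation using (factorise)
open import Data.Nat.ListAction using (product)
open import Data.Nat.ListAction.Properties using (∈⇒∣product)
open import Data.Nat.Tactic.RingSolver using (solve-∀)
open import Algebra.Properties.CommutativeSemigroup *-commutativeSemigroup using (x∙yz≈y∙xz)
open import Data.List using ([]; _∷_; length; filter; map; applyUpTo; upTo)
open import Data.List.Properties using (map-applyUpTo)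
open import Data.List.Membership.Propositional.Properties using (∈-upTo⁺; ∈-filter⁺)
open import Data.List.Relation.Unary.All using (_∷_)
import Data.List.Relation.Unary.All as All
open import Data.List.Relation.Unary.All.Properties using (all-filter)
open import Data.Product using (Σ; _×_; _,_; proj₁)
open import Data.Sum using (inj₁; inj₂)
open import Function using (_∘_; id; it; _⇔_; mk⇔; Equivalence)
open import Relation.Nullary using (Dec; yes; no; ¬_; contradiction)
open import Relation.Nullary.Decidable using (_×-dec_; ¬?)
open import Relation.Unary using (Decidable)
open import Relation.Binary.PropositionalEquality using (_≡_; _≢_; refl; sym; trans; cong; cong₂; subst; subst₂; module ≡-Reasoning)

open ≡-Reasoning
open Equivalence using (to; from)

indicator : {P : Set} → Dec P → ℕ
indicator (yes _) = 1
indicator (no _)  = 0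

indicator-cong : {P Q : Set} (P? : Dec P) (Q? : Dec Q) → P ⇔ Q → indicator P? ≡ indicator Q?
indicator-cong (yes _) (yes _) _   = refl
indicator-cong (yes p) (no ¬q) P⇔Q = contradiction (to P⇔Q p) ¬q
indicator-cong (no ¬p) (yes q) P⇔Q = contradiction (from P⇔Q q) ¬p
indicator-cong (no _)  (no _)  _   = refl

count : {P : ℕ → Set} → Decidable P → ℕ → ℕ → ℕ
count P? s zero    = 0
count P? s (suc n) = indicator (P? s) + count P? (suc s) n

Periodic : (ℕ → Set) → ℕ → Set
Periodic P y = ∀ m → P (m + y) ⇔ P m

module _ {P : ℕ → Set} (P? : Decidable P) where

  length-filter-∷ : ∀ x xs → length (filter P? (x ∷ xs)) ≡ indicator (P? x) + length (filter P? xs)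
  length-filter-∷ x xs with P? x
  ... | yes _ = refl
  ... | no _  = refl

  length-filter-applyUpTo : ∀ f s n → (∀ i → f i ≡ s + i) →
    length (filter P? (applyUpTo f n)) ≡ count P? s n
  length-filter-applyUpTo f s zero    f≡ = refl
  length-filter-applyUpTo f s (suc n) f≡ = begin
      length (filter P? (f 0 ∷ applyUpTo (f ∘ suc) n))
    ≡⟨ length-filter-∷ (f 0) _ ⟩
      indicator (P? (f 0)) + length (filter P? (applyUpTo (f ∘ suc) n))
    ≡⟨ cong₂ _+_ (cong (indicator ∘ P?) (trans (f≡ 0) (+-identityʳ s)))
                 (length-filter-applyUpTo (f ∘ suc) (suc s) n (λ i → trans (f≡ (suc i)) (+-suc s i))) ⟩
      count P? s (suc n)
    ∎

  count-+ : ∀ s n m → count P? s (n + m) ≡ count P? s n + count P? (s + n) m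
  count-+ s zero    m = cong (λ t → count P? t m) (sym (+-identityʳ s))
  count-+ s (suc n) m rewrite count-+ (suc s) n m | +-suc s n = sym (+-assoc (indicator (P? s)) _ _)

  count-none : ∀ s n → (∀ m → s ≤ m → m < s + n → ¬ P m) → count P? s n ≡ 0
  count-none s zero    _    = refl
  count-none s (suc n) none with P? s
  ... | yes Ps = contradiction Ps (none s ≤-refl (m<m+n s z<s))
  ... | no _   = count-none (suc s) n λ m s<m m<s+1+n →
                   none m (<⇒≤ s<m) (subst (m <_) (sym (+-suc s n)) m<s+1+n)

  module _ {y : ℕ} (periodic : Periodic P y) where

    count-shift : ∀ s n → count P? (s + y) n ≡ count P? s n
    count-shift s zero    = refl
    count-shift s (suc n) = cong₂ _+_ (indicator-cong (P? (s + y)) (P? s) (periodic s))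
                                      (count-shift (suc s) n)

    count-rotate : ∀ s → count P? (suc s) y ≡ count P? s y
    count-rotate s = +-cancelˡ-≡ (indicator (P? s)) _ _ (begin
        count P? s (1 + y)
      ≡⟨ cong (count P? s) (+-comm 1 y) ⟩
        count P? s (y + 1)
      ≡⟨ count-+ s y 1 ⟩
        count P? s y + (indicator (P? (s + y)) + 0)
      ≡⟨ cong (count P? s y +_) (trans (+-identityʳ _) (indicator-cong (P? (s + y)) (P? s) (periodic s))) ⟩
        count P? s y + indicator (P? s)
      ≡⟨ +-comm _ (indicator (P? s)) ⟩
        indicator (P? s) + count P? s y
      ∎)

    count-*-period : ∀ s x → count P? s (x * y) ≡ x * count P? s y
    count-*-period s zero    = refl
    count-*-period s (suc x) rewrite count-+ s y (x * y) | count-shift s (x * y)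
                                   | count-*-period s x = refl

count-cong : {P Q : ℕ → Set} (P? : Decidable P) (Q? : Decidable Q) → (∀ m → P m ⇔ Q m) →
  ∀ s n → count P? s n ≡ count Q? s n
count-cong P? Q? P⇔Q s zero    = refl
count-cong P? Q? P⇔Q s (suc n) = cong₂ _+_ (indicator-cong (P? s) (Q? s) (P⇔Q s)) (count-cong P? Q? P⇔Q (suc s) n)

count-partition : {P Q : ℕ → Set} (P? : Decidable P) (Q? : Decidable Q) → ∀ s n →
  count P? s n ≡ count (λ m → P? m ×-dec Q? m) s n + count (λ m → P? m ×-dec ¬? (Q? m)) s n
count-partition P? Q? s zero = refl
count-partition P? Q? s (suc n) with P? s | Q? s
... | yes _ | yes _ = cong suc (count-partition P? Q? (suc s) n)
... | yes _ | no _  = trans (cong suc (count-partition P? Q? (suc s) n)) (sym (+-suc _ _))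
... | no _  | yes _ = count-partition P? Q? (suc s) n
... | no _  | no _  = count-partition P? Q? (suc s) n

∤-between-multiples : ∀ p s m → p * s < m → m < p * s + p → ¬ p ∣ m
∤-between-multiples p s m ps<m m<ps+p p∣m = >⇒∤ {{r≢0}} r<p p∣r
  where
  r = m ∸ p * s
  ps+r≡m : p * s + r ≡ m
  ps+r≡m = m+[n∸m]≡n (<⇒≤ ps<m)
  r≢0 : NonZero r
  r≢0 = >-nonZero (m<n⇒0<n∸m ps<m)
  r<p : r < p
  r<p = +-cancelˡ-< (p * s) r p (subst (_< p * s + p) (sym ps+r≡m) m<ps+p)
  p∣r : p ∣ r
  p∣r = ∣m+n∣m⇒∣n (subst (p ∣_) (sym ps+r≡m) p∣m) (m∣m*n s)

count-multiples-block : {R : ℕ → Set} (R? : Decidable R) (p : ℕ) .{{_ : NonZero p}} → ∀ s →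
  count (λ m → R? m ×-dec p ∣? m) (p * s) p ≡ indicator (R? (p * s))
count-multiples-block R? p@(suc p′) s = begin
    indicator (R∧p∣? (p * s)) + count R∧p∣? (suc (p * s)) p′
  ≡⟨ cong₂ _+_ (indicator-cong (R∧p∣? (p * s)) (R? (p * s)) (mk⇔ proj₁ (_, m∣m*n s)))
               (count-none R∧p∣? (suc (p * s)) p′ λ m ps<m m<ps+p (_ , p∣m) →
                  ∤-between-multiples p s m ps<m (subst (m <_) (sym (+-suc (p * s) p′)) m<ps+p) p∣m) ⟩
    indicator (R? (p * s)) + 0
  ≡⟨ +-identityʳ _ ⟩
    indicator (R? (p * s))
  ∎
  where R∧p∣? = λ m → R? m ×-dec p ∣? m

count-multiples : {R : ℕ → Set} (R? : Decidable R) (p : ℕ) .{{_ : NonZero p}} → ∀ s n →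
  count (λ m → R? m ×-dec p ∣? m) (p * s) (p * n) ≡ count (R? ∘ (p *_)) s n
count-multiples R? p s zero    rewrite *-zeroʳ p = refl
count-multiples R? p s (suc n) = begin
    count R∧p∣? (p * s) (p * suc n)
  ≡⟨ cong (count R∧p∣? (p * s)) (*-suc p n) ⟩
    count R∧p∣? (p * s) (p + p * n)
  ≡⟨ count-+ R∧p∣? (p * s) p (p * n) ⟩
    count R∧p∣? (p * s) p + count R∧p∣? (p * s + p) (p * n)
  ≡⟨ cong₂ _+_ (count-multiples-block R? p s)
               (trans (cong (λ t → count R∧p∣? t (p * n)) (trans (+-comm (p * s) p) (sym (*-suc p s))))
                      (count-multiples R? p (suc s) n)) ⟩
    count (R? ∘ (p *_)) s (suc n)
  ∎
  where R∧p∣? = λ m → R? m ×-dec p ∣? m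

coprime-∣ˡ : ∀ {d m n} → d ∣ m → Coprime m n → Coprime d n
coprime-∣ˡ d∣m coprime (i∣d , i∣n) = coprime (∣-trans i∣d d∣m , i∣n)

coprime-* : ∀ {m x y} → Coprime m x → Coprime m y → Coprime m (x * y)
coprime-* coprime-x coprime-y (i∣m , i∣xy) =
  coprime-y (i∣m , coprime-divisor (coprime-∣ˡ i∣m coprime-x) i∣xy)

coprime-*⇒coprimeʳ : ∀ {m} x {y} → Coprime m (x * y) → Coprime m y
coprime-*⇒coprimeʳ x coprime (i∣m , i∣y) = coprime (i∣m , ∣n⇒∣m*n x i∣y)

coprime-periodic : ∀ n → Periodic (λ m → Coprime m n) n
coprime-periodic n m = mk⇔ coprime-+⁻ (subst (λ t → Coprime t n) (+-comm n m) ∘ coprime-+)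
  where
  coprime-+⁻ : Coprime (m + n) n → Coprime m n
  coprime-+⁻ coprime (i∣m , i∣n) = coprime (∣m∣n⇒∣m+n i∣m i∣n , i∣n)

∤⇒coprime : ∀ {p m} → Prime p → ¬ p ∣ m → Coprime m p
∤⇒coprime p-prime p∤m (i∣m , i∣p) with prime⇒irreducible p-prime i∣p
... | inj₁ i≡1 = i≡1
... | inj₂ i≡p = contradiction (subst (_∣ _) i≡p i∣m) p∤m

prime-divisor : ∀ d → d ≢ 1 → Σ ℕ λ q → Prime q × q ∣ d
prime-divisor zero      _   = 2 , prime[2] , 2 ∣0
prime-divisor d@(suc _) d≢1 with factorise d
... | record { factors = [] ; isFactorisation = d≡1 } = contradiction d≡1 d≢1
... | record { factors = q ∷ qs ; isFactorisation = d≡∏ ; factorsPrime = q-prime ∷ _ } =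
  q , q-prime , subst (q ∣_) (sym d≡∏) (m∣m*n (product qs))

coprime-radical : ∀ {m x y} → (∀ {q} → Prime q → q ∣ x → q ∣ y) → Coprime m y → Coprime m x
coprime-radical radical coprime {d} (d∣m , d∣x) with d ≟ 1
... | yes d≡1 = d≡1
... | no d≢1 with prime-divisor d d≢1
...   | q , q-prime , q∣d = contradiction
          (coprime (∣-trans q∣d d∣m , radical q-prime (∣-trans q∣d d∣x)))
          (λ q≡1 → ¬prime[1] (subst Prime q≡1 q-prime))

coprimeTo? : ∀ n → Decidable (λ m → Coprime m n)
coprimeTo? n m = coprime? m n

φ≡count : ∀ n → φ n ≡ count (coprimeTo? n) 0 n
φ≡count n = begin
    length (filter (coprimeTo? n) (map suc (applyUpTo id n)))
  ≡⟨ cong (length ∘ filter (coprimeTo? n)) (map-applyUpTo id suc n) ⟩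
    length (filter (coprimeTo? n) (applyUpTo suc n))
  ≡⟨ length-filter-applyUpTo (coprimeTo? n) suc 1 n (λ _ → refl) ⟩
    count (coprimeTo? n) 1 n
  ≡⟨ count-rotate (coprimeTo? n) (coprime-periodic n) 0 ⟩
    count (coprimeTo? n) 0 n
  ∎

φ-*-radical : ∀ x y → (∀ {q} → Prime q → q ∣ x → q ∣ y) → φ (x * y) ≡ x * φ y
φ-*-radical x y radical = begin
    φ (x * y)
  ≡⟨ φ≡count (x * y) ⟩
    count (coprimeTo? (x * y)) 0 (x * y)
  ≡⟨ count-cong (coprimeTo? (x * y)) (coprimeTo? y)
       (λ m → mk⇔ (coprime-*⇒coprimeʳ x) (λ coprime → coprime-* (coprime-radical radical coprime) coprime))
       0 (x * y) ⟩
    count (coprimeTo? y) 0 (x * y)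
  ≡⟨ count-*-period (coprimeTo? y) (coprime-periodic y) 0 x ⟩
    x * count (coprimeTo? y) 0 y
  ≡⟨ cong (x *_) (sym (φ≡count y)) ⟩
    x * φ y
  ∎

-- Of the p φ(M) integers in [0, pM) coprime to M, the multiples of p account for φ(M)
-- and the rest are exactly those coprime to pM.
φ-prime-* : ∀ t M → Prime (t + 1) → ¬ t + 1 ∣ M → φ ((t + 1) * M) ≡ t * φ M
φ-prime-* t M p-prime p∤M = +-cancelʳ-≡ (φ M) _ _ (begin
    φ (p * M) + φ M
  ≡⟨ +-comm (φ (p * M)) (φ M) ⟩
    φ M + φ (p * M)
  ≡⟨ cong₂ _+_ (sym multiples) (sym nonmultiples) ⟩
    count C∧p∣? 0 (p * M) + count C∧p∤? 0 (p * M)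
  ≡⟨ sym (count-partition (coprimeTo? M) (p ∣?_) 0 (p * M)) ⟩
    count (coprimeTo? M) 0 (p * M)
  ≡⟨ count-*-period (coprimeTo? M) (coprime-periodic M) 0 p ⟩
    p * count (coprimeTo? M) 0 M
  ≡⟨ cong (p *_) (sym (φ≡count M)) ⟩
    p * φ M
  ≡⟨ trans (*-distribʳ-+ (φ M) t 1) (cong (t * φ M +_) (*-identityˡ (φ M))) ⟩
    t * φ M + φ M
  ∎)
  where
  p = t + 1
  instance
    _ : NonZero p
    _ = prime⇒nonZero p-prime
  C∧p∣? = λ m → coprimeTo? M m ×-dec p ∣? m
  C∧p∤? = λ m → coprimeTo? M m ×-dec ¬? (p ∣? m)

  multiples : count C∧p∣? 0 (p * M) ≡ φ M
  multiples = begin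
      count C∧p∣? 0 (p * M)
    ≡⟨ cong (λ s → count C∧p∣? s (p * M)) (sym (*-zeroʳ p)) ⟩
      count C∧p∣? (p * 0) (p * M)
    ≡⟨ count-multiples (coprimeTo? M) p 0 M ⟩
      count (coprimeTo? M ∘ (p *_)) 0 M
    ≡⟨ count-cong (coprimeTo? M ∘ (p *_)) (coprimeTo? M) (λ j → mk⇔ (coprime-∣ˡ (n∣m*n p)) (p·-coprime j)) 0 M ⟩
      count (coprimeTo? M) 0 M
    ≡⟨ sym (φ≡count M) ⟩
      φ M
    ∎
    where
    p·-coprime : ∀ j → Coprime j M → Coprime (p * j) M
    p·-coprime j coprime = Coprimality.sym (coprime-* (∤⇒coprime p-prime p∤M) (Coprimality.sym coprime))

  nonmultiples : count C∧p∤? 0 (p * M) ≡ φ (p * M)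
  nonmultiples = begin
      count C∧p∤? 0 (p * M)
    ≡⟨ count-cong C∧p∤? (coprimeTo? (p * M)) (λ m → mk⇔ to′ from′) 0 (p * M) ⟩
      count (coprimeTo? (p * M)) 0 (p * M)
    ≡⟨ sym (φ≡count (p * M)) ⟩
      φ (p * M)
    ∎
    where
    to′ : ∀ {m} → Coprime m M × ¬ p ∣ m → Coprime m (p * M)
    to′ (coprime , p∤m) = coprime-* (∤⇒coprime p-prime p∤m) coprime
    from′ : ∀ {m} → Coprime m (p * M) → Coprime m M × ¬ p ∣ m
    from′ coprime = coprime-*⇒coprimeʳ p coprime ,
                    λ p∣m → ¬prime[1] (subst Prime (coprime (p∣m , m∣m*n M)) p-prime)

rad-nonZero : ∀ n → NonZero (rad n)
rad-nonZero n = productOfPrimes≢0 (All.map proj₁ (all-filter (λ p → prime? p ×-dec p ∣? n) (upTo (suc n))))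

prime∣⇒∣rad : ∀ {n q} → .{{NonZero n}} → Prime q → q ∣ n → q ∣ rad n
prime∣⇒∣rad {n} q-prime q∣n =
  ∈⇒∣product (∈-filter⁺ (λ p → prime? p ×-dec p ∣? n) (∈-upTo⁺ (s≤s (∣⇒≤ q∣n))) (q-prime , q∣n))

÷-*-cancel : ∀ {d m} → d ∣ m → m ÷ d * d ≡ m
÷-*-cancel {zero}  0∣m = sym (0∣⇒≡0 0∣m)
÷-*-cancel {suc d} d∣m = m/n*n≡m d∣m

÷-cross : ∀ {d a b} → d ∣ a → d ∣ b → a ÷ d * b ≡ b ÷ d * a
÷-cross {d} {a} {b} d∣a d∣b = begin
    a ÷ d * b
  ≡⟨ cong (a ÷ d *_) (sym (÷-*-cancel d∣b)) ⟩
    a ÷ d * (b ÷ d * d)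
  ≡⟨ x∙yz≈y∙xz (a ÷ d) (b ÷ d) d ⟩
    b ÷ d * (a ÷ d * d)
  ≡⟨ cong (b ÷ d *_) (÷-*-cancel d∣a) ⟩
    b ÷ d * a
  ∎

÷-mono-< : ∀ {d a b} → d ∣ a → d ∣ b → a < b → a ÷ d < b ÷ d
÷-mono-< {d} d∣a d∣b a<b = *-cancelʳ-< d _ _ (subst₂ _<_ (sym (÷-*-cancel d∣a)) (sym (÷-*-cancel d∣b)) a<b)

÷-nonZero : ∀ {d a} → .{{NonZero a}} → d ∣ a → NonZero (a ÷ d)
÷-nonZero {d} {a} d∣a = m*n≢0⇒m≢0 (a ÷ d) {{subst NonZero (sym (÷-*-cancel d∣a)) it}}

cross-shift : ∀ {a b a′ b′} n M → a′ * b ≡ b′ * a → a′ ≤ b′ →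
  (b * n + 1) * (a′ * M) + (b′ ∸ a′) * M ≡ (a * n + 1) * (b′ * M)
cross-shift {a} {b} {a′} {b′} n M cross a′≤b′ with b′ ∸ a′ | m+[n∸m]≡n a′≤b′
... | d | refl = begin
    (b * n + 1) * (a′ * M) + d * M
  ≡⟨ expand a′ b n d M ⟩
    a′ * b * (n * M) + (a′ + d) * M
  ≡⟨ cong (λ x → x * (n * M) + (a′ + d) * M) cross ⟩
    (a′ + d) * a * (n * M) + (a′ + d) * M
  ≡⟨ collect a n (a′ + d) M ⟩
    (a * n + 1) * ((a′ + d) * M)
  ∎
  where
  expand : ∀ a′ b n d M → (b * n + 1) * (a′ * M) + d * M ≡ a′ * b * (n * M) + (a′ + d) * M
  expand = solve-∀
  collect : ∀ a n b′ M → b′ * a * (n * M) + b′ * M ≡ (a * n + 1) * (b′ * M)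
  collect = solve-∀

φ-cross : ∀ {a b a′ b′} n M → a′ * b ≡ b′ * a →
  (∀ {q} → Prime q → q ∣ a′ → q ∣ M) → (∀ {q} → Prime q → q ∣ b′ → q ∣ M) →
  Prime (a * n + 1) → Prime (b * n + 1) → ¬ a * n + 1 ∣ b′ * M → ¬ b * n + 1 ∣ a′ * M →
  φ ((b * n + 1) * (a′ * M)) ≡ φ ((a * n + 1) * (b′ * M))
φ-cross {a} {b} {a′} {b′} n M cross radical-a′ radical-b′ p-prime q-prime p∤b′M q∤a′M = begin
    φ ((b * n + 1) * (a′ * M))
  ≡⟨ φ-prime-* (b * n) (a′ * M) q-prime q∤a′M ⟩
    b * n * φ (a′ * M)
  ≡⟨ cong (b * n *_) (φ-*-radical a′ M radical-a′) ⟩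
    b * n * (a′ * φ M)
  ≡⟨ rearrange₁ b n a′ (φ M) ⟩
    a′ * b * (n * φ M)
  ≡⟨ cong (_* (n * φ M)) cross ⟩
    b′ * a * (n * φ M)
  ≡⟨ rearrange₂ b′ a n (φ M) ⟩
    a * n * (b′ * φ M)
  ≡⟨ cong (a * n *_) (sym (φ-*-radical b′ M radical-b′)) ⟩
    a * n * φ (b′ * M)
  ≡⟨ sym (φ-prime-* (a * n) (b′ * M) p-prime p∤b′M) ⟩
    φ ((a * n + 1) * (b′ * M))
  ∎
  where
  rearrange₁ : ∀ x y z w → x * y * (z * w) ≡ z * x * (y * w)
  rearrange₁ = solve-∀
  rearrange₂ : ∀ x y z w → x * y * (z * w) ≡ y * z * (x * w)
  rearrange₂ = solve-∀

≤⇒*+1∤ : ∀ x {m n} → .{{NonZero x}} → .{{NonZero m}} → m ≤ n → ¬ x * n + 1 ∣ m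
≤⇒*+1∤ x {n = n} m≤n = >⇒∤ (≤-<-trans (m≤n⇒m≤o*n x m≤n) (m<m+n (x * n) z<s))

φ-solution : ∀ {a b a′ b′ M} → .{{NonZero a}} → .{{NonZero b}} → .{{NonZero a′}} → .{{NonZero M}} →
  a′ * b ≡ b′ * a → a′ < b′ →
  (∀ {q} → Prime q → q ∣ a′ → q ∣ M) → (∀ {q} → Prime q → q ∣ b′ → q ∣ M) →
  ∀ n → b′ * M ≤ n → Prime (a * n + 1) → Prime (b * n + 1) →
  φ ((b * n + 1) * (a′ * M) + (b′ ∸ a′) * M) ≡ φ ((b * n + 1) * (a′ * M))
φ-solution {a} {b} {a′} {b′} {M} cross a′<b′ radical-a′ radical-b′ n b′M≤n p-prime q-prime = begin
    φ ((b * n + 1) * (a′ * M) + (b′ ∸ a′) * M)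
  ≡⟨ cong φ (cross-shift n M cross (<⇒≤ a′<b′)) ⟩
    φ ((a * n + 1) * (b′ * M))
  ≡⟨ sym (φ-cross n M cross radical-a′ radical-b′ p-prime q-prime p∤b′M q∤a′M) ⟩
    φ ((b * n + 1) * (a′ * M))
  ∎
  where
  instance
    b′≢0 : NonZero b′
    b′≢0 = >-nonZero (≤-<-trans z≤n a′<b′)
    a′M≢0 : NonZero (a′ * M)
    a′M≢0 = m*n≢0 a′ M
    b′M≢0 : NonZero (b′ * M)
    b′M≢0 = m*n≢0 b′ M
  p∤b′M : ¬ a * n + 1 ∣ b′ * M
  p∤b′M = ≤⇒*+1∤ a b′M≤n
  q∤a′M : ¬ b * n + 1 ∣ a′ * M
  q∤a′M = ≤⇒*+1∤ b (≤-trans (*-monoˡ-≤ M (<⇒≤ a′<b′)) b′M≤n)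

φ-solutions : ∀ {a b a′ b′ M} → .{{NonZero a}} → .{{NonZero b}} → .{{NonZero a′}} → .{{NonZero M}} →
  a′ * b ≡ b′ * a → a′ < b′ →
  (∀ {q} → Prime q → q ∣ a′ → q ∣ M) → (∀ {q} → Prime q → q ∣ b′ → q ∣ M) →
  (∀ N → Σ ℕ λ n → N ≤ n × Prime (a * n + 1) × Prime (b * n + 1)) →
  ∀ N → Σ ℕ λ w → N ≤ w × φ (w + (b′ ∸ a′) * M) ≡ φ w
φ-solutions {a} {b} {a′} {b′} {M} cross a′<b′ radical-a′ radical-b′ prime-pairs N
  with prime-pairs (N + b′ * M)
... | n , N+b′M≤n , p-prime , q-prime =
  (b * n + 1) * (a′ * M) ,
  ≤-trans (m≤m+n N (b′ * M)) (≤-trans N+b′M≤n n≤w) ,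
  φ-solution cross a′<b′ radical-a′ radical-b′ n (≤-trans (m≤n+m (b′ * M) N) N+b′M≤n) p-prime q-prime
  where
  instance
    a′M≢0 : NonZero (a′ * M)
    a′M≢0 = m*n≢0 a′ M
  n≤w : n ≤ (b * n + 1) * (a′ * M)
  n≤w = ≤-trans (m≤n*m n b) (≤-trans (m≤m+n (b * n) 1) (m≤m*n (b * n + 1) (a′ * M)))

lemma3 : (a b : ℕ) → 1 ≤ a → a < b →
    ((N : ℕ) → Σ ℕ (λ n → N ≤ n × Prime (a * n + 1) × Prime (b * n + 1))) →
    (k : ℕ) → 1 ≤ k → κ a b ∣ k →
    (N : ℕ) → Σ ℕ (λ n → N ≤ n × φ (n + k) ≡ φ n)
lemma3 a b 1≤a a<b prime-pairs k 1≤k (divides c k≡c*κ) =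
  subst (λ k → ∀ N → Σ ℕ λ w → N ≤ w × φ (w + k) ≡ φ w) (sym k≡[b′-a′]M)
    (φ-solutions (÷-cross g∣a g∣b) a′<b′ (radical (m∣m*n b′)) (radical (n∣m*n a′)) prime-pairs)
  where
  g∣a = gcd[m,n]∣m a b
  g∣b = gcd[m,n]∣n a b
  a′ = a ÷ gcd a b
  b′ = b ÷ gcd a b
  a′<b′ = ÷-mono-< g∣a g∣b a<b
  M = c * rad (a′ * b′)
  k≡[b′-a′]M : k ≡ (b′ ∸ a′) * M
  k≡[b′-a′]M = trans k≡c*κ (x∙yz≈y∙xz c (b′ ∸ a′) (rad (a′ * b′)))
  instance
    a≢0 : NonZero a
    a≢0 = >-nonZero 1≤a
    b≢0 : NonZero b
    b≢0 = >-nonZero (≤-trans 1≤a (<⇒≤ a<b))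
    a′≢0 : NonZero a′
    a′≢0 = ÷-nonZero g∣a
    b′≢0 : NonZero b′
    b′≢0 = >-nonZero (≤-<-trans z≤n a′<b′)
    c≢0 : NonZero c
    c≢0 = m*n≢0⇒m≢0 c {{subst NonZero k≡c*κ (>-nonZero 1≤k)}}
    a′b′≢0 : NonZero (a′ * b′)
    a′b′≢0 = m*n≢0 a′ b′
    rad≢0 : NonZero (rad (a′ * b′))
    rad≢0 = rad-nonZero (a′ * b′)
    M≢0 : NonZero M
    M≢0 = m*n≢0 c (rad (a′ * b′))
  radical : ∀ {x} → x ∣ a′ * b′ → ∀ {q} → Prime q → q ∣ x → q ∣ M
  radical x∣a′b′ q-prime q∣x = ∣n⇒∣m*n c (prime∣⇒∣rad q-prime (∣-trans q∣x x∣a′b′))
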